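{- Let $k\geq 2$ and $n\geq 0$. The Foata--Strehl tree of every short $k$-Catalan--Spitzer permutation of order $n$ is levelwise numbered.
   Context: A $k$-Catalan--Spitzer path of order $n$ is a lattice path $(0,z'_0),(1,z'_1),\ldots,(kn+1,z'_{kn+1})$ with $z'_0=z'_{kn+1}=0$, consisting of $(k-1)n+1$ up steps $(1,n)$ and $n$ down steps $(1,-((k-1)n+1))$, with $z'_i>0$ for $1\leq i\leq kn$. Letting $i_1<\cdots<i_{(k-1)n}$ be the indices $i\in\{1,\ldots,kn\}$ with $z'_i<z'_{i+1}$, the short $k$-Catalan--Spitzer permutation of the path is the permutation $\sigma$ of $\{1,\ldots,(k-1)n\}$ with $\sigma(a)<\sigma(b)$ iff $z'_{i_a}<z'_{i_b}$. The Foata--Strehl tree $\mathcal{FS}(w_1\cdots w_m)$ of a word with distinct letters is the rooted tree (each vertex with at most one left and one right child) defined recursively: the root is labeled $w_i=\min(w_1,\ldots,w_m)$, the left subtree is $\mathcal{FS}(w_1\cdots w_{i-1})$ (absent if $i=1$), the right subtree is $\mathcal{FS}(w_{i+1}\cdots w_m)$ (absent if $i=m$). The level of a vertex is the number of parent-to-right-child steps on the path from the root to it. A tree with vertices labeled bijectively by $1,\ldots,m$ is levelwise numbered if: (1) whenever the level of the vertex labeled $i$ is less than that of the vertex labeled $j$, then $i<j$; (2) whenever the vertex labeled $j$ is in the left subtree of the vertex labeled $i$, then $i<j$; (3) whenever the vertices labeled $i$ and $j$ have the same level and there is a label $l<i,j$ with the vertex labeled $i$ in the right subtree and the vertex labeled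 $j$ in the left subtree of the vertex labeled $l$, then $i<j$. -}

module Defs where

open import Data.Nat as ℕ using (ℕ; zero; suc; _+_; _*_; _∸_)
open import Data.Integer as ℤ using (ℤ; +_; -_)
open import Data.Bool using (Bool; true; false; if_then_else_)
open import Data.List using (List; []; _∷_; _++_; length; map; upTo; lookup; filter; last)
open import Data.List.Relation.Unary.All using (All)
open import Data.List.Relation.Binary.Permutation.Propositional using (_↭_)
open import Data.Maybe using (just)
open import Data.Fin using (Fin; cast)
open import Data.Product using (Σ; _×_)
open import Function.Bundles using (_⇔_)
open import Relation.Binary.PropositionalEquality using (_≡_)
open import Relation.Nullary using (yes; no)
open import Data.Unit using (⊤)

-- k-Catalan--Spitzer paths.
-- A path is encoded by its list of steps (true = up step (1,n),
-- false = down step (1, -((k-1)n+1))).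

stepHeight : ℕ → ℕ → Bool → ℤ
stepHeight k n true  = + n
stepHeight k n false = - (+ ((k ∸ 1) * n + 1))

-- heights k n z bs = list of heights after each step, starting at height z;
-- for a path, heights k n 0ℤ bs = z'_1 , … , z'_{kn+1}.
heights : ℕ → ℕ → ℤ → List Bool → List ℤ
heights k n z []       = []
heights k n z (b ∷ bs) = (z ℤ.+ stepHeight k n b) ∷ heights k n (z ℤ.+ stepHeight k n b) bs

count : Bool → List Bool → ℕ
count b []       = 0
count true  (true  ∷ bs) = suc (count true bs)
count true  (false ∷ bs) = count true bs
count false (true  ∷ bs) = count false bs
count false (false ∷ bs) = suc (count false bs)

InitPositive : List ℤ → Set
InitPositive []           = ⊤
InitPositive (z ∷ [])     = ⊤
InitPositive (z ∷ w ∷ zs) = (ℤ.0ℤ ℤ.< z) × InitPositive (w ∷ zs)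

record CatalanSpitzerPath (k n : ℕ) (bs : List Bool) : Set where
  field
    len      : length bs ≡ k * n + 1
    ups      : count true bs ≡ (k ∸ 1) * n + 1
    downs    : count false bs ≡ n
    endsAt0  : last (heights k n ℤ.0ℤ bs) ≡ just ℤ.0ℤ
    positive : InitPositive (heights k n ℤ.0ℤ bs)

ascentFrom : ℤ → List ℤ → List ℤ
ascentFrom z []       = []
ascentFrom z (w ∷ zs) =
  (if Relation.Nullary.Decidable.does (z ℤ.<? w) then z ∷ ascentFrom w zs else ascentFrom w zs)
  where import Relation.Nullary.Decidable

ascentValues : List ℤ → List ℤ
ascentValues []       = []
ascentValues (z ∷ zs) = ascentFrom z zs

ascentHeights : ℕ → ℕ → List Bool → List ℤ
ascentHeights k n bs = ascentValues (heights k n ℤ.0ℤ bs)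

oneTo : ℕ → List ℕ
oneTo m = map suc (upTo m)

IsShortCSPermutation : ℕ → ℕ → List Bool → List ℕ → Set
IsShortCSPermutation k n bs w =
  (w ↭ oneTo (length w)) ×
  Σ (length w ≡ length (ascentHeights k n bs)) λ eq →
    ∀ (a b : Fin (length w)) →
      (lookup w a ℕ.< lookup w b) ⇔
      (lookup (ascentHeights k n bs) (cast eq a) ℤ.< lookup (ascentHeights k n bs) (cast eq b))

-- Binary trees with labelled vertices; leaf = absent subtree.

data Tree : Set where
  leaf : Tree
  node : Tree → ℕ → Tree → Tree

-- Foata--Strehl tree, as the graph of its recursive definition:
-- FS w t  means  t = FS(w).
data FS : List ℕ → Tree → Set where
  fs-[] : FS [] leaf
  fs-split : ∀ {l r tl tr x} →
    All (x ℕ.<_) l → All (x ℕ.<_) r →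
    FS l tl → FS r tr →
    FS (l ++ x ∷ r) (node tl x tr)

data Dir : Set where
  L R : Dir

data At : Tree → List Dir → ℕ → Set where
  here  : ∀ {l x r} → At (node l x r) [] x
  left  : ∀ {l x r p y} → At l p y → At (node l x r) (L ∷ p) y
  right : ∀ {l x r p y} → At r p y → At (node l x r) (R ∷ p) y

level : List Dir → ℕ
level []      = 0
level (L ∷ p) = level p
level (R ∷ p) = suc (level p)

record LevelwiseNumbered (t : Tree) : Set where
  field
    cond1 : ∀ {p q i j} → At t p i → At t q j → level p ℕ.< level q → i ℕ.< j
    cond2 : ∀ {p q i j} → At t p i → At t (p ++ L ∷ q) j → i ℕ.< j
    cond3 : ∀ {p q q' l i j} →
      At t p l → At t (p ++ R ∷ q) i → At t (p ++ L ∷ q') j →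
      level (p ++ R ∷ q) ≡ level (p ++ L ∷ q') →
      l ℕ.< i → l ℕ.< j → i ℕ.< j

-- Write the height of an ascent as q·n − d, where d < n is the number of down steps before it;
-- the band q rises by one at each up step and falls by k − 1 at each down step. Ascent heights
-- are thus ordered lexicographically by (q , −d), and along the path d never decreases while
-- consecutive ascents raise q by at most one. By induction on the Foata–Strehl tree, a vertex at
-- level ℓ has band q₀ + ℓ, q₀ the band of the first ascent: the root is an ascent of least band,
-- the left subtree still contains the first ascent, and the right subtree consists of later
-- ascents, of band at least q₀ + 1, the first of them exactly q₀ + 1. So a higher level means a
-- larger label, and of two vertices of equal level on the two sides of a branching vertex the
-- right one lies later on the path, hence has more down steps before it and a smaller label.
module Submission where

open import Defs
open import Data.Nat using (ℕ; zero; suc; _+_; _*_; _≤_; _<_; _∸_; z≤n; s≤s)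
import Data.Nat.Properties as ℕP
open import Data.Integer as ℤ using (ℤ; +_)
import Data.Integer.Properties as ℤP
open import Data.Integer.Tactic.RingSolver using (solve-∀)
open import Data.Bool using (Bool; true; false)
open import Data.List using (List; []; _∷_; _++_; map; zip; length; lookup; last)
open import Data.List.Properties using (∷-injective; length-map)
open import Data.List.Relation.Unary.All as All using (All; []; _∷_)
import Data.List.Relation.Unary.All.Properties as AllP
open import Data.List.Relation.Unary.AllPairs using (AllPairs; []; _∷_)
import Data.List.Relation.Unary.AllPairs.Properties as AllPairsP
open import Data.List.Relation.Unary.Linked as Linked using (Linked; []; [-]; _∷_)
import Data.List.Relation.Unary.Linked.Properties as LinkedP
open import Data.List.Relation.Unary.Any using (here; there)
open import Data.List.Membership.Propositional using (_∈_)
open import Data.List.Membership.Propositional.Properties using (∈-++⁺ˡ; ∈-++⁺ʳ)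
open import Data.Maybe using (just)
import Data.Maybe.Properties as MaybeP
open import Data.Fin using (cast) renaming (zero to fzero; suc to fsuc)
open import Data.Product using (∃; _×_; _,_; proj₁; proj₂; map₂)
open import Data.Sum using (_⊎_; inj₁; inj₂)
open import Data.Unit using (⊤; tt)
open import Data.Empty using (⊥-elim)
open import Function.Base using (_∘_; _on_)
open import Function.Bundles using (_⇔_; Equivalence)
open import Relation.Binary using (tri<; tri≈; tri>)
open import Relation.Binary.PropositionalEquality
open import Relation.Nullary using (yes; no)
open import Relation.Nullary.Decidable using (dec-true; dec-false; does)

Key : Set
Key = ℤ × ℕ

band : Key → ℤ
band = proj₁

drops : Key → ℕ
drops = proj₂

_≺_ : Key → Key → Set
x ≺ y = band x ℤ.< band y ⊎ (band x ≡ band y × drops y < drops x)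

Precedes : Key → Key → Set
Precedes x y = drops x ≤ drops y × (drops x ≡ drops y → band x ℤ.< band y)

BandStep : Key → Key → Set
BandStep x y = band y ℤ.≤ ℤ.suc (band x)

HeadBand≤ : ℤ → List Key → Set
HeadBand≤ q []      = ⊤
HeadBand≤ q (x ∷ _) = band x ℤ.≤ q

≺-cmp : ∀ x y → x ≺ y ⊎ x ≡ y ⊎ y ≺ x
≺-cmp (q , d) (q′ , d′) with ℤP.<-cmp q q′
... | tri< q<q′ _ _ = inj₁ (inj₁ q<q′)
... | tri> _ _ q>q′ = inj₂ (inj₂ (inj₁ q>q′))
... | tri≈ _ refl _ with ℕP.<-cmp d d′
...   | tri< d<d′ _ _ = inj₂ (inj₂ (inj₂ (refl , d<d′)))
...   | tri≈ _ refl _ = inj₂ (inj₁ refl)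
...   | tri> _ _ d>d′ = inj₁ (inj₂ (refl , d>d′))

≺⇒band≤ : ∀ {x y} → x ≺ y → band x ℤ.≤ band y
≺⇒band≤ (inj₁ q<q′)     = ℤP.<⇒≤ q<q′
≺⇒band≤ (inj₂ (q≡q′ , _)) = ℤP.≤-reflexive q≡q′

precedes-≺⇒band< : ∀ {x y} → Precedes x y → x ≺ y → band x ℤ.< band y
precedes-≺⇒band< _            (inj₁ q<q′)        = q<q′
precedes-≺⇒band< (d≤d′ , _) (inj₂ (_ , d′<d)) = ⊥-elim (ℕP.<⇒≱ d′<d d≤d′)

precedes-≻⇒drops< : ∀ {x y} → Precedes x y → y ≺ x → drops x < drops y
precedes-≻⇒drops< (d≤d′ , same-drops⇒q<q′) y≺x with ℕP.m≤n⇒m<n∨m≡n d≤d′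
... | inj₁ d<d′ = d<d′
... | inj₂ d≡d′ = ⊥-elim (ℤP.<⇒≱ (same-drops⇒q<q′ d≡d′) (≺⇒band≤ y≺x))

Entry : Set
Entry = ℕ × Key

label : Entry → ℕ
label = proj₁

key : Entry → Key
key = proj₂

record Banded (q : ℤ) (S : List Entry) : Set where
  field
    label<⇒≺  : ∀ {x y} → x ∈ S → y ∈ S → label x < label y → key x ≺ key y
    ≺⇒label<  : ∀ {x y} → x ∈ S → y ∈ S → key x ≺ key y → label x < label y
    precedes  : AllPairs (Precedes on key) S
    bandSteps : Linked (BandStep on key) S
    bandsFrom : All (λ e → q ℤ.≤ band (key e)) S
    headBand  : HeadBand≤ q (map key S)

banded-[] : ∀ {q} → Banded q []
banded-[] = record
  { label<⇒≺ = λ () ; ≺⇒label< = λ () ; precedes = [] ; bandSteps = [] ; bandsFrom = [] ; headBand = tt }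

key-injective : ∀ {q S x y} → Banded q S → x ∈ S → y ∈ S → label x ≡ label y → key x ≡ key y
key-injective {x = x} {y} B x∈ y∈ same with ≺-cmp (key x) (key y)
... | inj₁ x≺y        = ⊥-elim (ℕP.<-irrefl same (Banded.≺⇒label< B x∈ y∈ x≺y))
... | inj₂ (inj₁ x≡y) = x≡y
... | inj₂ (inj₂ y≺x) = ⊥-elim (ℕP.<-irrefl (sym same) (Banded.≺⇒label< B y∈ x∈ y≺x))

AllPairs-++⁻ : ∀ {A : Set} {R : A → A → Set} (xs : List A) {ys} → AllPairs R (xs ++ ys) →
  AllPairs R xs × AllPairs R ys × All (λ x → All (R x) ys) xs
AllPairs-++⁻ []       rs         = [] , rs , []
AllPairs-++⁻ (x ∷ xs) (rx ∷ rs) with AllPairs-++⁻ xs rs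
... | rxs , rys , across = AllP.++⁻ˡ xs rx ∷ rxs , rys , AllP.++⁻ʳ xs rx ∷ across

Linked-++⁻ : ∀ {A : Set} {R : A → A → Set} (xs : List A) {ys} → Linked R (xs ++ ys) →
  Linked R xs × Linked R ys
Linked-++⁻ []           rs       = [] , rs
Linked-++⁻ (x ∷ [])     rs       = [-] , Linked.tail rs
Linked-++⁻ (x ∷ y ∷ xs) (r ∷ rs) with Linked-++⁻ (y ∷ xs) rs
... | rxs , rys = r ∷ rxs , rys

map-++-∷⁻ : ∀ {A B : Set} (f : A → B) (xs : List A) {l y r} → l ++ y ∷ r ≡ map f xs →
  ∃ λ xl → ∃ λ x → ∃ λ xr → xs ≡ xl ++ x ∷ xr × map f xl ≡ l × f x ≡ y × map f xr ≡ r
map-++-∷⁻ f []       {[]}    ()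
map-++-∷⁻ f []       {_ ∷ _} ()
map-++-∷⁻ f (x ∷ xs) {[]}    refl = [] , x , xs , refl , refl , refl , refl
map-++-∷⁻ f (x ∷ xs) {_ ∷ l} eq with ∷-injective eq
... | refl , eq′ with map-++-∷⁻ f xs eq′
...   | xl , x′ , xr , refl , refl , refl , refl = x ∷ xl , x′ , xr , refl , refl , refl , refl

-- FS (map label S) t, recording for each vertex the entry of S it is labelled by.
data EntryFS : List Entry → Tree → Set where
  leaf : EntryFS [] leaf
  node : ∀ {Sl x Sr tl tr} →
    All (λ e → label x < label e) Sl → All (λ e → label x < label e) Sr →
    EntryFS Sl tl → EntryFS Sr tr → EntryFS (Sl ++ x ∷ Sr) (node tl (label x) tr)

fromFS : ∀ S {w t} → FS w t → w ≡ map label S → EntryFS S t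
fromFS []      fs-[] _  = leaf
fromFS (_ ∷ _) fs-[] ()
fromFS S (fs-split x<l x<r fl fr) eq with map-++-∷⁻ label S eq
... | Sl , x , Sr , refl , refl , refl , refl =
  node (AllP.map⁻ x<l) (AllP.map⁻ x<r) (fromFS Sl fl refl) (fromFS Sr fr refl)

entryAt : ∀ {S t p y} → EntryFS S t → At t p y → ∃ λ e → e ∈ S × label e ≡ y
entryAt (node {Sl} _ _ _ _) here = _ , ∈-++⁺ʳ Sl (here refl) , refl
entryAt (node _ _ tl _) (left a) with entryAt tl a
... | e , e∈ , refl = e , ∈-++⁺ˡ e∈ , refl
entryAt (node {Sl} _ _ _ tr) (right a) with entryAt tr a
... | e , e∈ , refl = e , ∈-++⁺ʳ Sl (there e∈) , refl

headBand-++ˡ : ∀ {q} Sl {x Sr} → HeadBand≤ q (map key (Sl ++ x ∷ Sr)) → HeadBand≤ q (map key Sl)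
headBand-++ˡ []      _ = tt
headBand-++ˡ (_ ∷ _) h = h

headBand-root : ∀ {q} Sl {x Sr} → HeadBand≤ q (map key (Sl ++ x ∷ Sr)) →
  All (λ e → key x ≺ key e) Sl → band (key x) ℤ.≤ q
headBand-root []      h _           = h
headBand-root (_ ∷ _) h (x≺e ∷ _) = ℤP.≤-trans (≺⇒band≤ x≺e) h

headBand-step : ∀ {x} Sr → Linked (BandStep on key) (x ∷ Sr) → HeadBand≤ (ℤ.suc (band (key x))) (map key Sr)
headBand-step []      _       = tt
headBand-step (_ ∷ _) (s ∷ _) = s

module Node {q Sl x Sr} (B : Banded q (Sl ++ x ∷ Sr))
  (x<Sl : All (λ e → label x < label e) Sl) (x<Sr : All (λ e → label x < label e) Sr) where
  open Banded B

  ∈ˡ : ∀ {e} → e ∈ Sl → e ∈ Sl ++ x ∷ Sr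
  ∈ˡ = ∈-++⁺ˡ

  ∈ˣ : x ∈ Sl ++ x ∷ Sr
  ∈ˣ = ∈-++⁺ʳ Sl (here refl)

  ∈ʳ : ∀ {e} → e ∈ Sr → e ∈ Sl ++ x ∷ Sr
  ∈ʳ e∈ = ∈-++⁺ʳ Sl (there e∈)

  x≺ˡ : ∀ {e} → e ∈ Sl → key x ≺ key e
  x≺ˡ e∈ = label<⇒≺ ∈ˣ (∈ˡ e∈) (All.lookup x<Sl e∈)

  x≺ʳ : ∀ {e} → e ∈ Sr → key x ≺ key e
  x≺ʳ e∈ = label<⇒≺ ∈ˣ (∈ʳ e∈) (All.lookup x<Sr e∈)

  precedes-split : AllPairs (Precedes on key) Sl × AllPairs (Precedes on key) (x ∷ Sr) ×
                   All (λ e → All (Precedes (key e) ∘ key) (x ∷ Sr)) Sl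
  precedes-split = AllPairs-++⁻ Sl precedes

  steps-split : Linked (BandStep on key) Sl × Linked (BandStep on key) (x ∷ Sr)
  steps-split = Linked-++⁻ Sl bandSteps

  precedesˡ : ∀ {e} → e ∈ Sl → Precedes (key e) (key x)
  precedesˡ e∈ with All.lookup (proj₂ (proj₂ precedes-split)) e∈
  ... | e→x ∷ _ = e→x

  precedesʳ : ∀ {e} → e ∈ Sr → Precedes (key x) (key e)
  precedesʳ e∈ with proj₁ (proj₂ precedes-split)
  ... | x→Sr ∷ _ = All.lookup x→Sr e∈

  band-root : band (key x) ≡ q
  band-root = ℤP.≤-antisym (headBand-root Sl headBand (All.tabulate x≺ˡ)) (All.lookup bandsFrom ∈ˣ)

  banded-left : Banded q Sl
  banded-left = record
    { label<⇒≺  = λ e∈ e′∈ → label<⇒≺ (∈ˡ e∈) (∈ˡ e′∈)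
    ; ≺⇒label<  = λ e∈ e′∈ → ≺⇒label< (∈ˡ e∈) (∈ˡ e′∈)
    ; precedes  = proj₁ precedes-split
    ; bandSteps = proj₁ steps-split
    ; bandsFrom = AllP.++⁻ˡ Sl bandsFrom
    ; headBand  = headBand-++ˡ Sl headBand
    }

  banded-right : Banded (ℤ.suc q) Sr
  banded-right = record
    { label<⇒≺  = λ e∈ e′∈ → label<⇒≺ (∈ʳ e∈) (∈ʳ e′∈)
    ; ≺⇒label<  = λ e∈ e′∈ → ≺⇒label< (∈ʳ e∈) (∈ʳ e′∈)
    ; precedes  = AllPairs-tail (proj₁ (proj₂ precedes-split))
    ; bandSteps = Linked.tail (proj₂ steps-split)
    ; bandsFrom = All.tabulate λ e∈ →
        subst (λ b → ℤ.suc b ℤ.≤ _) band-root (ℤP.i<j⇒suc[i]≤j (precedes-≺⇒band< (precedesʳ e∈) (x≺ʳ e∈)))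
    ; headBand  = subst (λ b → HeadBand≤ (ℤ.suc b) (map key Sr)) band-root (headBand-step Sr (proj₂ steps-split))
    }
    where
    AllPairs-tail : ∀ {R : Entry → Entry → Set} {y ys} → AllPairs R (y ∷ ys) → AllPairs R ys
    AllPairs-tail (_ ∷ rs) = rs

  -- Left descendants of x come before it on the path and right ones after it, so at equal
  -- bands a right descendant has more drops than a left one.
  right-before-left : ∀ {ei ej} → ei ∈ Sr → ej ∈ Sl → band (key ei) ≡ band (key ej) → label ei < label ej
  right-before-left ei∈ ej∈ same-band =
    ≺⇒label< (∈ʳ ei∈) (∈ˡ ej∈)
      (inj₂ (same-band , ℕP.<-≤-trans (precedes-≻⇒drops< (precedesˡ ej∈) (x≺ˡ ej∈)) (proj₁ (precedesʳ ei∈))))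

level-band-suc : ∀ m q → + m ℤ.+ ℤ.suc q ≡ + suc m ℤ.+ q
level-band-suc m q = trans (sym (ℤP.+-assoc (+ m) ℤ.1ℤ q)) (cong (λ k → + k ℤ.+ q) (ℕP.+-comm m 1))

band-level : ∀ {q S t p y} → Banded q S → EntryFS S t → At t p y →
  ∀ {e} → e ∈ S → label e ≡ y → band (key e) ≡ + level p ℤ.+ q
band-level {q} B (node x<Sl x<Sr _ _) here e∈ same =
  trans (cong band (key-injective B e∈ ∈ˣ same)) (trans band-root (sym (ℤP.+-identityˡ q)))
  where open Node B x<Sl x<Sr
band-level B (node x<Sl x<Sr tl _) (left a) e∈ refl with entryAt tl a
... | e′ , e′∈ , same =
  trans (cong band (key-injective B e∈ (∈ˡ e′∈) (sym same))) (band-level banded-left tl a e′∈ same)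
  where open Node B x<Sl x<Sr
band-level {q} {p = R ∷ p} B (node x<Sl x<Sr _ tr) (right a) e∈ refl with entryAt tr a
... | e′ , e′∈ , same =
  trans (cong band (key-injective B e∈ (∈ʳ e′∈) (sym same)))
        (trans (band-level banded-right tr a e′∈ same) (level-band-suc (level p) q))
  where open Node B x<Sl x<Sr

levels-ordered : ∀ {q S t p p′ i j} → Banded q S → EntryFS S t → At t p i → At t p′ j →
  level p < level p′ → i < j
levels-ordered {q} B T a b lt with entryAt T a | entryAt T b
... | ei , ei∈ , refl | ej , ej∈ , refl =
  Banded.≺⇒label< B ei∈ ej∈ (inj₁ (subst₂ ℤ._<_ (sym (band-level B T a ei∈ refl)) (sym (band-level B T b ej∈ refl))
                                             (ℤP.+-monoˡ-< q (ℤ.+<+ lt))))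

left-descendant-larger : ∀ {S t p r i j} → EntryFS S t → At t p i → At t (p ++ L ∷ r) j → i < j
left-descendant-larger (node x<Sl _ tl _) here (left b) with entryAt tl b
... | e , e∈ , refl = All.lookup x<Sl e∈
left-descendant-larger (node _ _ tl _) (left a)  (left b)  = left-descendant-larger tl a b
left-descendant-larger (node _ _ _ tr) (right a) (right b) = left-descendant-larger tr a b

right-of-branch-smaller : ∀ {q S t p r r′ l i j} → Banded q S → EntryFS S t →
  At t p l → At t (p ++ R ∷ r) i → At t (p ++ L ∷ r′) j →
  level (p ++ R ∷ r) ≡ level (p ++ L ∷ r′) → i < j
right-of-branch-smaller {q} B T@(node x<Sl x<Sr tl tr) here (right b) (left c) same-level
  with entryAt tr b | entryAt tl c
... | ei , ei∈ , refl | ej , ej∈ , refl =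
  right-before-left ei∈ ej∈
    (trans (band-level B T (right b) (∈ʳ ei∈) refl)
    (trans (cong (λ m → + m ℤ.+ q) same-level) (sym (band-level B T (left c) (∈ˡ ej∈) refl))))
  where open Node B x<Sl x<Sr
right-of-branch-smaller B (node x<Sl x<Sr tl _) (left a) (left b) (left c) same-level =
  right-of-branch-smaller (Node.banded-left B x<Sl x<Sr) tl a b c same-level
right-of-branch-smaller B (node x<Sl x<Sr _ tr) (right a) (right b) (right c) same-level =
  right-of-branch-smaller (Node.banded-right B x<Sl x<Sr) tr a b c (ℕP.suc-injective same-level)

levelwiseNumbered : ∀ {q S t} → Banded q S → EntryFS S t → LevelwiseNumbered t
levelwiseNumbered B T = record
  { cond1 = levels-ordered B T
  ; cond2 = left-descendant-larger T
  ; cond3 = λ a b c same-level _ _ → right-of-branch-smaller B T a b c same-level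
  }

∈-zip⇒lookup : ∀ {A B C : Set} (f : B → C) (xs : List A) (ys : List B) (eq : length xs ≡ length (map f ys)) →
  ∀ {p} → p ∈ zip xs ys →
  ∃ λ a → lookup xs a ≡ proj₁ p × lookup (map f ys) (cast eq a) ≡ f (proj₂ p)
∈-zip⇒lookup f (x ∷ xs) (y ∷ ys) eq (here refl) = fzero , refl , refl
∈-zip⇒lookup f (x ∷ xs) (y ∷ ys) eq (there p∈) with ∈-zip⇒lookup f xs ys (ℕP.suc-injective eq) p∈
... | a , eqˡ , eqʳ = fsuc a , eqˡ , eqʳ

map-proj-zip : ∀ {A B : Set} (xs : List A) (ys : List B) → length xs ≡ length ys →
  map proj₁ (zip xs ys) ≡ xs × map proj₂ (zip xs ys) ≡ ys
map-proj-zip []       []       _  = refl , refl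
map-proj-zip (x ∷ xs) (y ∷ ys) eq with map-proj-zip xs ys (ℕP.suc-injective eq)
... | eq₁ , eq₂ = cong (x ∷_) eq₁ , cong (y ∷_) eq₂

ascentFrom-positive : ∀ z zs → InitPositive (z ∷ zs) → All (ℤ.0ℤ ℤ.<_) (ascentFrom z zs)
ascentFrom-positive z []       _            = []
ascentFrom-positive z (z′ ∷ zs) (0<z , pos) with does (z ℤ.<? z′)
... | true  = 0<z ∷ ascentFrom-positive z′ zs pos
... | false = ascentFrom-positive z′ zs pos

SameOrder : (w : List ℕ) (zs : List ℤ) → length w ≡ length zs → Set
SameOrder w zs eq = ∀ a b → (lookup w a < lookup w b) ⇔ (lookup zs (cast eq a) ℤ.< lookup zs (cast eq b))

-- An up step taken at height q·n − d after d down steps gets the key (q , d).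
module UpSteps (k n : ℕ) where

  height : Key → ℤ
  height (q , d) = q ℤ.* + n ℤ.- + d

  upKeys : Key → List Bool → List Key
  upKeys _       []           = []
  upKeys (q , d) (true ∷ bs)  = (q , d) ∷ upKeys (ℤ.suc q , d) bs
  upKeys (q , d) (false ∷ bs) = upKeys (q ℤ.- + (k ∸ 1) , suc d) bs

  height-up : ∀ q d → height (q , d) ℤ.+ stepHeight k n true ≡ height (ℤ.suc q , d)
  height-up q d = ring q (+ n) (+ d)
    where
    ring : ∀ (q n d : ℤ) → (q ℤ.* n ℤ.- d) ℤ.+ n ≡ (ℤ.1ℤ ℤ.+ q) ℤ.* n ℤ.- d
    ring = solve-∀

  height-down : ∀ q d → height (q , d) ℤ.+ stepHeight k n false ≡ height (q ℤ.- + (k ∸ 1) , suc d)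
  height-down q d =
    trans (cong (λ m → height (q , d) ℤ.+ ℤ.- (m ℤ.+ ℤ.1ℤ)) (ℤP.pos-* (k ∸ 1) n)) (ring q (+ n) (+ d) (+ (k ∸ 1)))
    where
    ring : ∀ (q n d c : ℤ) → (q ℤ.* n ℤ.- d) ℤ.+ ℤ.- (c ℤ.* n ℤ.+ ℤ.1ℤ) ≡ (q ℤ.- c) ℤ.* n ℤ.- (ℤ.1ℤ ℤ.+ d)
    ring = solve-∀

  i<i+n : 0 < n → ∀ i → i ℤ.< i ℤ.+ + n
  i<i+n 0<n i = subst (ℤ._< i ℤ.+ + n) (ℤP.+-identityʳ i) (ℤP.+-monoʳ-< i (ℤ.+<+ 0<n))

  ascentFrom-upKeys : 0 < n → ∀ x bs → ascentFrom (height x) (heights k n (height x) bs) ≡ map height (upKeys x bs)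
  ascentFrom-upKeys _ _ [] = refl
  ascentFrom-upKeys 0<n (q , d) (true ∷ bs)
    rewrite dec-true (height (q , d) ℤ.<? height (q , d) ℤ.+ + n) (i<i+n 0<n (height (q , d)))
          | height-up q d = cong (height (q , d) ∷_) (ascentFrom-upKeys 0<n (ℤ.suc q , d) bs)
  ascentFrom-upKeys 0<n (q , d) (false ∷ bs)
    rewrite dec-false (height (q , d) ℤ.<? height (q , d) ℤ.+ stepHeight k n false)
                      (ℤP.≤⇒≯ (ℤP.i-j≤i (height (q , d)) (+ ((k ∸ 1) * n + 1))))
          | height-down q d = ascentFrom-upKeys 0<n (q ℤ.- + (k ∸ 1) , suc d) bs

  upKeys-after : ∀ x bs → All (λ y → drops x ≤ drops y × (drops x ≡ drops y → band x ℤ.≤ band y)) (upKeys x bs)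
  upKeys-after _       []           = []
  upKeys-after (q , d) (true ∷ bs)  =
    (ℕP.≤-refl , λ _ → ℤP.≤-refl) ∷ All.map (map₂ (ℤP.≤-trans (ℤP.i≤suc[i] q) ∘_)) (upKeys-after (ℤ.suc q , d) bs)
  upKeys-after (q , d) (false ∷ bs) =
    All.map (λ (d<d′ , _) → ℕP.<⇒≤ d<d′ , λ d≡d′ → ⊥-elim (ℕP.<-irrefl d≡d′ d<d′)) (upKeys-after (q ℤ.- + (k ∸ 1) , suc d) bs)

  upKeys-precedes : ∀ x bs → AllPairs Precedes (upKeys x bs)
  upKeys-precedes _       []           = []
  upKeys-precedes (q , d) (true ∷ bs)  =
    All.map (λ (d≤d′ , f) → d≤d′ , λ d≡d′ → ℤP.suc[i]≤j⇒i<j (f d≡d′)) (upKeys-after (ℤ.suc q , d) bs)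
    ∷ upKeys-precedes (ℤ.suc q , d) bs
  upKeys-precedes (q , d) (false ∷ bs) = upKeys-precedes (q ℤ.- + (k ∸ 1) , suc d) bs

  upKeys-headBand : ∀ x bs → HeadBand≤ (band x) (upKeys x bs)
  upKeys-headBand _       []           = tt
  upKeys-headBand _       (true ∷ bs)  = ℤP.≤-refl
  upKeys-headBand (q , d) (false ∷ bs) with upKeys (q ℤ.- + (k ∸ 1) , suc d) bs
                                          | upKeys-headBand (q ℤ.- + (k ∸ 1) , suc d) bs
  ... | []    | _ = tt
  ... | _ ∷ _ | h = ℤP.≤-trans h (ℤP.i-j≤i q (+ (k ∸ 1)))

  upKeys-bandSteps : ∀ x bs → Linked BandStep (upKeys x bs)
  upKeys-bandSteps _       []           = []
  upKeys-bandSteps (q , d) (true ∷ bs)  with upKeys (ℤ.suc q , d) bs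
                                           | upKeys-headBand (ℤ.suc q , d) bs | upKeys-bandSteps (ℤ.suc q , d) bs
  ... | []    | _ | _     = [-]
  ... | _ ∷ _ | h | steps = h ∷ steps
  upKeys-bandSteps (q , d) (false ∷ bs) = upKeys-bandSteps (q ℤ.- + (k ∸ 1) , suc d) bs

  -- Every up step is followed by a down step, so it has fewer drops than the path has down steps.
  upKeys-drops< : ∀ x bs → last bs ≡ just false → All (λ y → drops y < drops x + count false bs) (upKeys x bs)
  upKeys-drops< (q , d) (true ∷ b ∷ bs) ends =
    ℕP.m<m+n d (downs-positive (b ∷ bs) ends) ∷ upKeys-drops< (ℤ.suc q , d) (b ∷ bs) ends
    where
    downs-positive : ∀ bs → last bs ≡ just false → 0 < count false bs
    downs-positive (false ∷ [])     _    = s≤s z≤n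
    downs-positive (true ∷ b ∷ bs)  ends = downs-positive (b ∷ bs) ends
    downs-positive (false ∷ _ ∷ _)  _    = s≤s z≤n
  upKeys-drops< _       (false ∷ [])     _    = []
  upKeys-drops< (q , d) (false ∷ b ∷ bs) ends =
    All.map (λ {y} → subst (drops y <_) (sym (ℕP.+-suc d _))) (upKeys-drops< (q ℤ.- + (k ∸ 1) , suc d) (b ∷ bs) ends)

  height-positive⇒band-positive : ∀ x → ℤ.0ℤ ℤ.< height x → ℤ.1ℤ ℤ.≤ band x
  height-positive⇒band-positive (q , d) pos with ℤ.1ℤ ℤ.≤? q
  ... | yes 1≤q = 1≤q
  ... | no 1≰q  = ⊥-elim (ℤP.<⇒≱ pos (ℤP.≤-trans (ℤP.i-j≤i (q ℤ.* + n) (+ d)) (ℤP.*-monoʳ-≤-nonNeg (+ n) q≤0)))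
    where
    q≤0 : q ℤ.≤ ℤ.0ℤ
    q≤0 = ℤP.i<j⇒i≤pred[j] (ℤP.≰⇒> 1≰q)

  ≺⇒height< : ∀ x y → drops y < n → x ≺ y → height x ℤ.< height y
  ≺⇒height< (q , d) (q , d′) _ (inj₂ (refl , d′<d)) = ℤP.+-monoʳ-< (q ℤ.* + n) (ℤP.neg-mono-< (ℤ.+<+ d′<d))
  ≺⇒height< (q , d) (q′ , d′) d′<n (inj₁ q<q′) = begin-strict
    q ℤ.* + n ℤ.- + d          ≤⟨ ℤP.i-j≤i (q ℤ.* + n) (+ d) ⟩
    q ℤ.* + n                  ≡⟨ sym (ℤP.+-identityʳ (q ℤ.* + n)) ⟩
    q ℤ.* + n ℤ.+ ℤ.0ℤ         <⟨ ℤP.+-monoʳ-< (q ℤ.* + n) 0<n-d′ ⟩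
    q ℤ.* + n ℤ.+ (+ n ℤ.- + d′) ≡⟨ ring q (+ n) (+ d′) ⟩
    ℤ.suc q ℤ.* + n ℤ.- + d′   ≤⟨ ℤP.+-monoˡ-≤ (ℤ.- + d′) (ℤP.*-monoʳ-≤-nonNeg (+ n) (ℤP.i<j⇒suc[i]≤j q<q′)) ⟩
    q′ ℤ.* + n ℤ.- + d′        ∎
    where
    open ℤP.≤-Reasoning
    0<n-d′ : ℤ.0ℤ ℤ.< + n ℤ.- + d′
    0<n-d′ = subst (ℤ.0ℤ ℤ.<_) (sym (trans (ℤP.m-n≡m⊖n n d′) (ℤP.⊖-≥ (ℕP.<⇒≤ d′<n)))) (ℤ.+<+ (ℕP.m<n⇒0<n∸m d′<n))
    ring : ∀ (q n d : ℤ) → q ℤ.* n ℤ.+ (n ℤ.- d) ≡ (ℤ.1ℤ ℤ.+ q) ℤ.* n ℤ.- d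
    ring = solve-∀

  height<⇒≺ : ∀ x y → drops x < n → height x ℤ.< height y → x ≺ y
  height<⇒≺ x y dx<n hx<hy with ≺-cmp x y
  ... | inj₁ x≺y        = x≺y
  ... | inj₂ (inj₁ refl) = ⊥-elim (ℤP.<-irrefl refl hx<hy)
  ... | inj₂ (inj₂ y≺x) = ⊥-elim (ℤP.<-asym hx<hy (≺⇒height< y x dx<n y≺x))

  ends-with-down : 0 < n → ∀ z b bs → ℤ.0ℤ ℤ.≤ z → last (heights k n z (b ∷ bs)) ≡ just ℤ.0ℤ →
    InitPositive (heights k n z (b ∷ bs)) → last (b ∷ bs) ≡ just false
  ends-with-down _   z false []       _   _    _ = refl
  ends-with-down 0<n z true  []       0≤z ends _ =
    ⊥-elim (ℤP.<-irrefl (sym (MaybeP.just-injective ends)) (ℤP.≤-<-trans 0≤z (i<i+n 0<n z)))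
  ends-with-down 0<n z b     (b′ ∷ bs) _  ends (0<z′ , pos) = ends-with-down 0<n _ b′ bs (ℤP.<⇒≤ 0<z′) ends pos

  banded-zip : ∀ {q} (w : List ℕ) K zs → zs ≡ map height K → (eq : length w ≡ length zs) → SameOrder w zs eq →
    All (λ y → drops y < n) K → All (λ y → q ℤ.≤ band y) K → HeadBand≤ q K →
    AllPairs Precedes K → Linked BandStep K → Banded q (zip w K)
  banded-zip w K _ refl eq sameOrder drops<n bandsFrom headBand precedes bandSteps = record
    { label<⇒≺  = label<⇒≺
    ; ≺⇒label<  = ≺⇒label<
    ; precedes  = AllPairsP.map⁻ (subst (AllPairs Precedes) (sym keys) precedes)
    ; bandSteps = LinkedP.map⁻ (subst (Linked BandStep) (sym keys) bandSteps)
    ; bandsFrom = AllP.map⁻ (subst (All _) (sym keys) bandsFrom)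
    ; headBand  = subst (HeadBand≤ _) (sym keys) headBand
    }
    where
    keys : map key (zip w K) ≡ K
    keys = proj₂ (map-proj-zip w K (trans eq (length-map height K)))

    drops<n′ : ∀ {x} → x ∈ zip w K → drops (key x) < n
    drops<n′ = All.lookup (AllP.map⁻ (subst (All _) (sym keys) drops<n))

    label<⇒≺ : ∀ {x y} → x ∈ zip w K → y ∈ zip w K → label x < label y → key x ≺ key y
    label<⇒≺ x∈ y∈ lt with ∈-zip⇒lookup height w K eq x∈ | ∈-zip⇒lookup height w K eq y∈
    ... | a , wa , ha | b , wb , hb =
      height<⇒≺ _ _ (drops<n′ x∈)
        (subst₂ ℤ._<_ ha hb (Equivalence.to (sameOrder a b) (subst₂ _<_ (sym wa) (sym wb) lt)))

    ≺⇒label< : ∀ {x y} → x ∈ zip w K → y ∈ zip w K → key x ≺ key y → label x < label y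
    ≺⇒label< x∈ y∈ x≺y with ∈-zip⇒lookup height w K eq x∈ | ∈-zip⇒lookup height w K eq y∈
    ... | a , wa , ha | b , wb , hb =
      subst₂ _<_ wa wb (Equivalence.from (sameOrder a b)
        (subst₂ ℤ._<_ (sym ha) (sym hb) (≺⇒height< _ _ (drops<n′ y∈) x≺y)))

  levelwiseNumbered-upFirst : 0 < n → ∀ bs → CatalanSpitzerPath k n (true ∷ bs) →
    ∀ w → IsShortCSPermutation k n (true ∷ bs) w → ∀ {t} → FS w t → LevelwiseNumbered t
  levelwiseNumbered-upFirst 0<n bs path w (_ , eq , sameOrder) fs =
    levelwiseNumbered
      (banded-zip w K _ ascents eq sameOrder drops<n bandsFrom (upKeys-headBand _ bs)
                  (upKeys-precedes _ bs) (upKeys-bandSteps _ bs))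
      (fromFS (zip w K) fs (sym labels))
    where
    open CatalanSpitzerPath path
    K : List Key
    K = upKeys (ℤ.1ℤ , 0) bs

    ascents : ascentHeights k n (true ∷ bs) ≡ map height K
    ascents = subst (λ z → ascentFrom z (heights k n z bs) ≡ map height K)
                    (trans (ℤP.+-identityʳ (ℤ.1ℤ ℤ.* + n)) (ℤP.*-identityˡ (+ n)))
                    (ascentFrom-upKeys 0<n _ bs)

    drops<n : All (λ y → drops y < n) K
    drops<n = subst (λ m → All (λ y → drops y < m) K) downs
                (All.tail (upKeys-drops< (ℤ.0ℤ , 0) (true ∷ bs) (ends-with-down 0<n ℤ.0ℤ true bs ℤP.≤-refl endsAt0 positive)))

    bandsFrom : All (λ y → ℤ.1ℤ ℤ.≤ band y) K
    bandsFrom = All.map (λ {y} → height-positive⇒band-positive y)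
                  (AllP.map⁻ (subst (All (ℤ.0ℤ ℤ.<_)) ascents (ascentFrom-positive _ _ positive)))

    labels : map label (zip w K) ≡ w
    labels = proj₁ (map-proj-zip w K (trans eq (trans (cong length ascents) (length-map height K))))

proposition4p12 : (k n : ℕ) → 2 ≤ k → (bs : List Bool) → CatalanSpitzerPath k n bs →
    (w : List ℕ) → IsShortCSPermutation k n bs w →
    (t : Tree) → FS w t → LevelwiseNumbered t
proposition4p12 k n _ bs path [] _ t fs = levelwiseNumbered (banded-[] {ℤ.0ℤ}) (fromFS [] fs refl)
proposition4p12 k n _ [] path (_ ∷ _) (_ , () , _) t fs
proposition4p12 k n _ (_ ∷ []) path (_ ∷ _) (_ , () , _) t fs
proposition4p12 k n _ (false ∷ _ ∷ _) path (_ ∷ _) _ t fs =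
  ⊥-elim (ℤP.<⇒≱ (proj₁ (CatalanSpitzerPath.positive path)) (ℤP.≤-trans (ℤP.≤-reflexive (ℤP.+-identityˡ (stepHeight k n false))) ℤP.neg-≤-pos))
proposition4p12 k zero _ (true ∷ _ ∷ _) path (_ ∷ _) _ t fs =
  ⊥-elim (ℕP.1+n≢0 (ℕP.suc-injective (trans (CatalanSpitzerPath.len path) (cong (_+ 1) (ℕP.*-zeroʳ k)))))
proposition4p12 k (suc n) _ (true ∷ bs) path w perm t fs =
  UpSteps.levelwiseNumbered-upFirst k (suc n) (s≤s z≤n) bs path w perm fs
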